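{- For every $\beta\in(0,1)$, algorithm CheapestPathApprox is an approximation algorithm for MS-OPT with approximation ratio $1/\beta$; i.e. the subgraph $G'$ it outputs is motivating for the reward $r$ it outputs, and $r\le r^*/\beta$, where $r^*$ is the minimum reward for which $G$ has a motivating subgraph.
   Context: A task graph is a finite directed acyclic graph $G=(V,E)$ with source $s$, target $t$ and non-negative edge costs $c_G(v,w)$; assume $t$ is reachable from $s$. For bias factor $\beta$, let $d_G(w)$ be the minimum cost of a path from $w$ to $t$ ($\infty$ if none), and for $v$ with an outgoing edge let $\zeta_G(v)=\min\{c_G(v,w)+\beta d_G(w):(v,w)\in E\}$ ($\infty$ otherwise). With reward $r\ge0$ at $t$, the agent starts at $s$ and at each vertex $v\ne t$ either moves along an edge $(v,w)$ attaining $\zeta_G(v)$ (ties arbitrary) if $\zeta_G(v)\le\beta r$, or abandons if $\zeta_G(v)>\beta r$. $G$ is motivating if for all tie-breakings the agent reaches $t$. A subgraph is obtained by deleting edges. MS-OPT: given $G$ and $\beta\in(0,1)$, find the minimum $r$ such that $G$ has a subgraph motivating for $r$. CheapestPathApprox: compute an $s$-$t$ path $P$ in $G$ of minimum total cost, let $G'$ consist of exactly the edges of $P$, and output $G'$ and $r=\max\{\zeta_{G'}(v): v\in P, v\ne t\}/\beta$.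
   Formalization: The edge costs, the bias factor β and the rewards are rational. -}

module Defs where

open import Data.Nat using (ℕ)
open import Data.Fin using (Fin; _≟_)
open import Data.Bool using (Bool; true; false; _∧_; _∨_)
open import Data.Rational using (ℚ; 0ℚ; 1ℚ; _+_; _*_; _≤_; _<_)
open import Data.Product using (Σ; ∃; _×_; _,_)
open import Data.Sum using (_⊎_)
open import Relation.Nullary using (¬_)
open import Relation.Nullary.Decidable using (⌊_⌋)
open import Relation.Binary.PropositionalEquality using (_≡_; _≢_)

data ℚ∞ : Set where
  fin : ℚ → ℚ∞
  ∞   : ℚ∞

infix 4 _≤∞_
data _≤∞_ : ℚ∞ → ℚ∞ → Set where
  fin≤fin : ∀ {x y} → x ≤ y → fin x ≤∞ fin y
  _≤∞-top : ∀ x → x ≤∞ ∞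

-- c + β · d   (with β > 0, so β · ∞ = ∞)
plusScaled : ℚ → ℚ → ℚ∞ → ℚ∞
plusScaled β c (fin x) = fin (c + β * x)
plusScaled β c ∞       = ∞

-- Graphs on vertex set Fin n: an edge relation E (a Bool per ordered
-- pair) together with an edge-cost function c.  A subgraph keeps the
-- costs and deletes edges.

EdgeSet : ℕ → Set
EdgeSet n = Fin n → Fin n → Bool

data Path {n : ℕ} (E : EdgeSet n) : Fin n → Fin n → Set where
  []  : ∀ {v} → Path E v v
  _∷_ : ∀ {v w u} → E v w ≡ true → Path E w u → Path E v u

pathCost : ∀ {n} {E : EdgeSet n} (c : Fin n → Fin n → ℚ) {v u : Fin n} →
           Path E v u → ℚ
pathCost c []                    = 0ℚ
pathCost c (_∷_ {v} {w} _ p)     = c v w + pathCost c p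

Acyclic : ∀ {n} → EdgeSet n → Set
Acyclic {n} E = ∀ (v w : Fin n) → E v w ≡ true → ¬ Path E w v

NonNegCosts : ∀ {n} → (Fin n → Fin n → ℚ) → Set
NonNegCosts {n} c = ∀ (v w : Fin n) → 0ℚ ≤ c v w

_⊆E_ : ∀ {n} → EdgeSet n → EdgeSet n → Set
_⊆E_ {n} E' E = ∀ (v w : Fin n) → E' v w ≡ true → E v w ≡ true

record IsTaskGraph {n : ℕ} (E : EdgeSet n) (c : Fin n → Fin n → ℚ)
                   (s t : Fin n) : Set where
  field
    acyclic   : Acyclic E
    nonneg    : NonNegCosts c
    reachable : Path E s t

data IsDist {n} (E : EdgeSet n) (c : Fin n → Fin n → ℚ) (t : Fin n)
            (w : Fin n) : ℚ∞ → Set where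
  reach   : (p : Path E w t) → (∀ (q : Path E w t) → pathCost c p ≤ pathCost c q) →
            IsDist E c t w (fin (pathCost c p))
  unreach : ¬ Path E w t → IsDist E c t w ∞

data IsZeta {n} (E : EdgeSet n) (c : Fin n → Fin n → ℚ) (t : Fin n) (β : ℚ)
            (v : Fin n) : ℚ∞ → Set where
  noOut    : (∀ (w : Fin n) → E v w ≡ false) → IsZeta E c t β v ∞
  attained : ∀ (w : Fin n) (dw : ℚ∞) → E v w ≡ true → IsDist E c t w dw →
             (∀ (w' : Fin n) (dw' : ℚ∞) → E v w' ≡ true → IsDist E c t w' dw' →
                plusScaled β (c v w) dw ≤∞ plusScaled β (c v w') dw') →
             IsZeta E c t β v (plusScaled β (c v w) dw)

-- The agent's behaviour.  `Succeeds E c t β r v` holds iff, starting at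
-- v, for every tie-breaking the agent reaches t: either v = t, or the
-- agent does not abandon at v (ζ(v) ≤ β r) and every edge (v,w) attaining
-- ζ(v) leads to a vertex from which the agent (again for all
-- tie-breakings) reaches t.  Being inductive, this demands that every run
-- is finite and ends at t.

data Succeeds {n} (E : EdgeSet n) (c : Fin n → Fin n → ℚ) (t : Fin n)
              (β r : ℚ) (v : Fin n) : Set where
  done : v ≡ t → Succeeds E c t β r v
  go   : v ≢ t →
         (∀ (z : ℚ∞) → IsZeta E c t β v z → z ≤∞ fin (β * r)) →
         (∀ (w : Fin n) (dw z : ℚ∞) → E v w ≡ true → IsDist E c t w dw →
            IsZeta E c t β v z → plusScaled β (c v w) dw ≡ z →
            Succeeds E c t β r w) →
         Succeeds E c t β r v

Motivating : ∀ {n} (E : EdgeSet n) (c : Fin n → Fin n → ℚ) (s t : Fin n)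
             (β r : ℚ) → Set
Motivating E c s t β r = Succeeds E c t β r s

pathEdges : ∀ {n} {E : EdgeSet n} {v u : Fin n} → Path E v u → EdgeSet n
pathEdges []                 a b = false
pathEdges (_∷_ {x} {y} _ p)  a b = (⌊ a ≟ x ⌋ ∧ ⌊ b ≟ y ⌋) ∨ pathEdges p a b

-- vertices of a path other than its final vertex
data _∈ₚ_ {n} {E : EdgeSet n} (a : Fin n) : ∀ {v u : Fin n} → Path E v u → Set where
  here  : ∀ {w u} {e : E a w ≡ true} {p : Path E w u} → a ∈ₚ (e ∷ p)
  there : ∀ {v w u} {e : E v w ≡ true} {p : Path E w u} → a ∈ₚ p → a ∈ₚ (e ∷ p)

IsCheapest : ∀ {n} (E : EdgeSet n) (c : Fin n → Fin n → ℚ) {s t : Fin n} →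
             Path E s t → Set
IsCheapest E c {s} {t} P = ∀ (q : Path E s t) → pathCost c P ≤ pathCost c q

-- m is the maximum of ζ_{G'}(v) over vertices v ≠ t of P, where G' = the
-- edges of P (taken to be 0 if P has no such vertex, i.e. s = t)
IsMaxZeta : ∀ {n} (E : EdgeSet n) (c : Fin n → Fin n → ℚ) {s t : Fin n}
            (β : ℚ) → Path E s t → ℚ∞ → Set
IsMaxZeta {n} E c {s} {t} β P m =
  (∀ (v : Fin n) (z : ℚ∞) → v ∈ₚ P → v ≢ t → IsZeta (pathEdges P) c t β v z → z ≤∞ m)
  × ((Σ (Fin n) λ v → v ∈ₚ P × v ≢ t × IsZeta (pathEdges P) c t β v m)
     ⊎ ((∀ (v : Fin n) → v ∈ₚ P → v ≡ t) × m ≡ fin 0ℚ))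

-- Let P be a cheapest s-t path, G' the subgraph made of the edges of P and
-- β r the largest value ζ_{G'}(v) over the vertices v ≠ t of P.
--
-- (1) G' is motivating for r.  Since G is acyclic, P never revisits a
--     vertex, so every vertex v ≠ t of P has exactly one out-edge in G',
--     the next edge of P.  Walking along the suffixes of P the agent never
--     abandons (ζ_{G'}(v) ≤ β r by the choice of r) and has no choice.
-- (2) β r ≤ cost(P).  ζ_{G'}(v) = c(v,w) + β d_{G'}(w) ≤ c(v,w) + d_{G'}(w),
--     and c(v,w) plus the cost of the rest of P after w is at most cost(P).
-- (3) If a subgraph G'' is motivating for r' then cost(P) ≤ r'.  The agent
--     does not abandon at s, so β r' ≥ ζ_{G''}(s) = c(s,w) + β d_{G''}(w)
--     ≥ β (c(s,w) + d_{G''}(w)) ≥ β cost(P), as P is cheapest in G ⊇ G''.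
--
-- Step (3) needs ζ_{G''}(s) to exist, so the file first shows that in an
-- acyclic graph distances and ζ exist: paths have fewer than n edges, all
-- paths of bounded length can be listed, and a finite list has a minimum.
module Submission where

open import Defs
open import Data.Nat using (ℕ)
open import Data.Fin using (Fin)
open import Data.Rational using (ℚ; 0ℚ; 1ℚ; _*_; _≤_; _<_)
open import Data.Product using (_×_)

import Data.Nat as ℕ
import Data.Nat.Properties as ℕ
open import Data.Fin using (zero; suc; _≟_)
open import Data.Fin.Properties using (injective⇒≤)
open import Data.Rational using (_+_; positive; nonNegative)
open import Data.Rational.Properties
  using (≤-refl; ≤-trans; ≤-total; ≤-antisym; ≤-reflexive; ≤-decTotalOrder; <⇒≤;
         +-monoʳ-≤; +-monoˡ-≤; +-mono-≤; +-identityˡ;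
         *-monoˡ-≤-nonNeg; *-monoʳ-≤-nonNeg; *-identityˡ; *-distribˡ-+; *-cancelˡ-≤-pos)
open import Data.Bool using (Bool; true; false; _∧_; _∨_)
open import Data.Bool.Properties using (∨-zeroʳ; ¬-not)
open import Data.List using (List; []; _∷_; _++_; map; concatMap; allFin)
open import Data.List.Relation.Unary.Any using (here; there)
import Data.List.Relation.Unary.Any as Any
open import Data.List.Relation.Unary.All using (lookup)
open import Data.List.Membership.Propositional using (_∈_; _∉_)
open import Data.List.Membership.Propositional.Properties
  using (∈-allFin; ∈-map⁺; ∈-concatMap⁺; ∈-++⁺ˡ; ∈-++⁺ʳ)
import Data.List.Extrema
open import Data.Product using (Σ; ∃; _,_; proj₁; proj₂)
open import Data.Sum using (_⊎_; inj₁; inj₂)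
open import Data.Empty using (⊥-elim)
open import Relation.Nullary using (yes; no)
open import Relation.Nullary.Decidable using (⌊_⌋)
open import Relation.Binary.Bundles using (TotalOrder; DecTotalOrder)
open import Relation.Binary.Structures using (IsTotalOrder)
open import Relation.Binary.PropositionalEquality
  using (_≡_; _≢_; refl; sym; trans; cong; subst; isEquivalence)

module Least {c ℓ₁ ℓ₂} (O : TotalOrder c ℓ₁ ℓ₂) where
  open TotalOrder O using (Carrier) renaming (_≤_ to _≼_)
  open Data.List.Extrema O using (argmin; f[argmin]≤f[⊤]; f[argmin]≤f[xs])

  least : {A : Set} (f : A → Carrier) (xs : List A) →
          (∀ {x} → x ∉ xs) ⊎ Σ A (λ m → ∀ {x} → x ∈ xs → f m ≼ f x)
  least f []       = inj₁ λ ()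
  least f (x ∷ xs) = inj₂ (argmin f x xs , minimal)
    where
      minimal : ∀ {y} → y ∈ x ∷ xs → f (argmin f x xs) ≼ f y
      minimal (here refl) = f[argmin]≤f[⊤] {f = f} x xs
      minimal (there y∈)  = lookup (f[argmin]≤f[xs] {f = f} x xs) y∈

≤∞-trans : ∀ {x y z} → x ≤∞ y → y ≤∞ z → x ≤∞ z
≤∞-trans {x} _           (_ ≤∞-top)  = x ≤∞-top
≤∞-trans (fin≤fin x≤y) (fin≤fin y≤z) = fin≤fin (≤-trans x≤y y≤z)

≤∞-isTotalOrder : IsTotalOrder _≡_ _≤∞_
≤∞-isTotalOrder = record
  { isPartialOrder = record
    { isPreorder = record
      { isEquivalence = isEquivalence
      ; reflexive     = λ { {fin x} refl → fin≤fin ≤-refl ; {∞} refl → ∞ ≤∞-top }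
      ; trans         = ≤∞-trans
      }
    ; antisym = antisym
    }
  ; total = total
  }
  where
    antisym : ∀ {x y} → x ≤∞ y → y ≤∞ x → x ≡ y
    antisym (fin≤fin x≤y) (fin≤fin y≤x) = cong fin (≤-antisym x≤y y≤x)
    antisym (_ ≤∞-top)    (_ ≤∞-top)    = refl

    total : ∀ x y → x ≤∞ y ⊎ y ≤∞ x
    total (fin x) (fin y) with ≤-total x y
    ... | inj₁ x≤y = inj₁ (fin≤fin x≤y)
    ... | inj₂ y≤x = inj₂ (fin≤fin y≤x)
    total x ∞ = inj₁ (x ≤∞-top)
    total ∞ y = inj₂ (y ≤∞-top)

≤∞-totalOrder : TotalOrder _ _ _
≤∞-totalOrder = record { isTotalOrder = ≤∞-isTotalOrder }

plusScaled-mono : ∀ β c {d₁ d₂} → 0ℚ ≤ β → d₁ ≤∞ d₂ →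
                  plusScaled β c d₁ ≤∞ plusScaled β c d₂
plusScaled-mono β c {d₁} _   (_ ≤∞-top)  = plusScaled β c d₁ ≤∞-top
plusScaled-mono β c 0≤β (fin≤fin d₁≤d₂) =
  fin≤fin (+-monoʳ-≤ c (*-monoˡ-≤-nonNeg β {{nonNegative 0≤β}} d₁≤d₂))

scale-≤ : ∀ β x → β ≤ 1ℚ → 0ℚ ≤ x → β * x ≤ x
scale-≤ β x β≤1 0≤x =
  ≤-trans (*-monoʳ-≤-nonNeg x {{nonNegative 0≤x}} β≤1) (≤-reflexive (*-identityˡ x))

module _ {n : ℕ} where

  embed : ∀ {F E : EdgeSet n} → F ⊆E E → ∀ {x y} → Path F x y → Path E x y
  embed F⊆E []                = []
  embed F⊆E (_∷_ {v} {w} e p) = F⊆E v w e ∷ embed F⊆E p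

  embed-cost : ∀ {F E : EdgeSet n} (c : Fin n → Fin n → ℚ) (F⊆E : F ⊆E E) →
               ∀ {x y} (p : Path F x y) → pathCost c (embed F⊆E p) ≡ pathCost c p
  embed-cost c F⊆E []                = refl
  embed-cost c F⊆E (_∷_ {v} {w} e p) = cong (c v w +_) (embed-cost c F⊆E p)

  acyclic-⊆ : ∀ {F E : EdgeSet n} → F ⊆E E → Acyclic E → Acyclic F
  acyclic-⊆ F⊆E acyclic v w e p = acyclic v w (F⊆E v w e) (embed F⊆E p)

  cost-nonneg : ∀ {E : EdgeSet n} (c : Fin n → Fin n → ℚ) → NonNegCosts c →
                ∀ {x y} (p : Path E x y) → 0ℚ ≤ pathCost c p
  cost-nonneg c nonneg []                = ≤-refl
  cost-nonneg c nonneg (_∷_ {v} {w} e p) =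
    subst (_≤ c v w + pathCost c p) (+-identityˡ 0ℚ)
      (+-mono-≤ (nonneg v w) (cost-nonneg c nonneg p))

  loop-cost : ∀ {E : EdgeSet n} (c : Fin n → Fin n → ℚ) → Acyclic E →
              ∀ {x y} (p : Path E x y) → x ≡ y → pathCost c p ≡ 0ℚ
  loop-cost c acyclic []                _    = refl
  loop-cost c acyclic (_∷_ {x} {w} e p) refl = ⊥-elim (acyclic x w e p)

  _++ₚ_ : ∀ {E : EdgeSet n} {x y z} → Path E x y → Path E y z → Path E x z
  []      ++ₚ q = q
  (e ∷ p) ++ₚ q = e ∷ (p ++ₚ q)

  ++ₚ-assoc : ∀ {E : EdgeSet n} {w x y z} (p : Path E w x) (q : Path E x y)
              (r : Path E y z) → (p ++ₚ q) ++ₚ r ≡ p ++ₚ (q ++ₚ r)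
  ++ₚ-assoc []      q r = refl
  ++ₚ-assoc (e ∷ p) q r = cong (e ∷_) (++ₚ-assoc p q r)

  ∈ₚ-++ʳ : ∀ {E : EdgeSet n} {a x y z} (p : Path E x y) {q : Path E y z} →
           a ∈ₚ q → a ∈ₚ (p ++ₚ q)
  ∈ₚ-++ʳ []      a∈q = a∈q
  ∈ₚ-++ʳ (e ∷ p) a∈q = there (∈ₚ-++ʳ p a∈q)

  length : ∀ {E : EdgeSet n} {x y} → Path E x y → ℕ
  length []      = 0
  length (_ ∷ p) = ℕ.suc (length p)

  vertexAt : ∀ {E : EdgeSet n} {x y} (p : Path E x y) → Fin (ℕ.suc (length p)) → Fin n
  vertexAt {x = x} p       zero    = x
  vertexAt         (_ ∷ p) (suc i) = vertexAt p i

  prefixTo : ∀ {E : EdgeSet n} {x y} (p : Path E x y) (i : Fin (ℕ.suc (length p))) →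
             Path E x (vertexAt p i)
  prefixTo p       zero    = []
  prefixTo (e ∷ p) (suc i) = e ∷ prefixTo p i

  vertexAt-injective : ∀ {E : EdgeSet n} → Acyclic E → ∀ {x y} (p : Path E x y) →
                       ∀ i j → vertexAt p i ≡ vertexAt p j → i ≡ j
  vertexAt-injective acyclic p                 zero    zero    _  = refl
  vertexAt-injective acyclic (_∷_ {v} {w} e p) zero    (suc j) eq =
    ⊥-elim (acyclic v w e (subst (Path _ w) (sym eq) (prefixTo p j)))
  vertexAt-injective acyclic (_∷_ {v} {w} e p) (suc i) zero    eq =
    ⊥-elim (acyclic v w e (subst (Path _ w) eq (prefixTo p i)))
  vertexAt-injective acyclic (e ∷ p)           (suc i) (suc j) eq =
    cong suc (vertexAt-injective acyclic p i j eq)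

  length-< : ∀ {E : EdgeSet n} → Acyclic E → ∀ {x y} (p : Path E x y) → length p ℕ.< n
  length-< acyclic p = injective⇒≤ (λ {i} {j} → vertexAt-injective acyclic p i j)

proofsOf : (b : Bool) → List (b ≡ true)
proofsOf true  = refl ∷ []
proofsOf false = []

proofsOf-complete : ∀ {b} (p : b ≡ true) → p ∈ proofsOf b
proofsOf-complete refl = here refl

module Enumeration {n : ℕ} (E : EdgeSet n) (t : Fin n) where

  OutEdge : Fin n → Set
  OutEdge v = Σ (Fin n) λ w → E v w ≡ true

  edgesTo : (v w : Fin n) → List (OutEdge v)
  edgesTo v w = map (w ,_) (proofsOf (E v w))

  outEdges : (v : Fin n) → List (OutEdge v)
  outEdges v = concatMap (edgesTo v) (allFin n)

  outEdges-complete : ∀ {v w} (e : E v w ≡ true) → (w , e) ∈ outEdges v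
  outEdges-complete {v} {w} e =
    ∈-concatMap⁺ (edgesTo v) (Any.map (λ { refl → ∈-map⁺ (w ,_) (proofsOf-complete e) }) (∈-allFin w))

  emptyPaths : (w : Fin n) → List (Path E w t)
  emptyPaths w with w ≟ t
  ... | yes refl = [] ∷ []
  ... | no _     = []

  emptyPaths-complete : [] ∈ emptyPaths t
  emptyPaths-complete with t ≟ t
  ... | yes refl = here refl
  ... | no t≢t   = ⊥-elim (t≢t refl)

  extendBy : ℕ → ∀ {w} → OutEdge w → List (Path E w t)

  pathsWithin : ℕ → (w : Fin n) → List (Path E w t)
  pathsWithin ℕ.zero    w = emptyPaths w
  pathsWithin (ℕ.suc k) w =
    emptyPaths w ++ concatMap (extendBy k) (outEdges w)

  extendBy k (x , e) = map (e ∷_) (pathsWithin k x)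

  pathsWithin-complete : ∀ k {w} (q : Path E w t) → length q ℕ.≤ k → q ∈ pathsWithin k w
  pathsWithin-complete ℕ.zero    []      _ = emptyPaths-complete
  pathsWithin-complete (ℕ.suc k) []      _ = ∈-++⁺ˡ emptyPaths-complete
  pathsWithin-complete (ℕ.suc k) {w} (e ∷ q) (ℕ.s≤s |q|≤k) =
    ∈-++⁺ʳ (emptyPaths w) (∈-concatMap⁺ (extendBy k) (Any.map
      (λ { refl → ∈-map⁺ (e ∷_) (pathsWithin-complete k q |q|≤k) }) (outEdges-complete e)))

module Existence {n : ℕ} (E : EdgeSet n) (c : Fin n → Fin n → ℚ) (t : Fin n)
                 (acyclic : Acyclic E) where
  open Enumeration E t

  allPaths-complete : ∀ {w} (q : Path E w t) → q ∈ pathsWithin n w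
  allPaths-complete q = pathsWithin-complete n q (ℕ.<⇒≤ (length-< acyclic q))

  dist : (w : Fin n) → ∃ (IsDist E c t w)
  dist w with Least.least (DecTotalOrder.totalOrder ≤-decTotalOrder) (pathCost c) (pathsWithin n w)
  ... | inj₁ none         = ∞ , unreach (λ q → none (allPaths-complete q))
  ... | inj₂ (p , p-least) = fin (pathCost c p) , reach p (λ q → p-least (allPaths-complete q))

  dist-≤ : ∀ {w d₁ d₂} → IsDist E c t w d₁ → IsDist E c t w d₂ → d₁ ≤∞ d₂
  dist-≤        (reach p p-least) (reach q _) = fin≤fin (p-least q)
  dist-≤ {d₁ = d₁} _               (unreach _) = d₁ ≤∞-top
  dist-≤        (unreach no-path) (reach q _) = ⊥-elim (no-path q)

  zeta : (β : ℚ) → 0ℚ ≤ β → (v : Fin n) → ∃ (IsZeta E c t β v)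
  zeta β 0≤β v with Least.least ≤∞-totalOrder value (outEdges v)
    where
      value : OutEdge v → ℚ∞
      value (w , _) = plusScaled β (c v w) (proj₁ (dist w))
  ... | inj₁ none = ∞ , noOut (λ w → ¬-not (λ e → none (outEdges-complete e)))
  ... | inj₂ ((w , e) , e-least) =
    _ , attained w (proj₁ (dist w)) e (proj₂ (dist w)) λ w' dw' e' dist-w' →
      ≤∞-trans (e-least (outEdges-complete e'))
        (plusScaled-mono β (c v w') 0≤β (dist-≤ (proj₂ (dist w')) dist-w'))

module _ {n : ℕ} {E : EdgeSet n} where

  pathEdges-∷ : ∀ {x y z a b} (e : E x y ≡ true) (q : Path E y z) →
                pathEdges (e ∷ q) a b ≡ true → (a ≡ x × b ≡ y) ⊎ pathEdges q a b ≡ true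
  pathEdges-∷ {x} {y} {a = a} {b} e q h with a ≟ x | b ≟ y
  ... | yes refl | yes refl = inj₁ (refl , refl)
  ... | yes refl | no _     = inj₂ h
  ... | no _     | _        = inj₂ h

  pathEdges-head : ∀ {x y z} (e : E x y ≡ true) (q : Path E y z) → pathEdges (e ∷ q) x y ≡ true
  pathEdges-head {x} {y} e q with x ≟ x | y ≟ y
  ... | yes _ | yes _ = refl
  ... | no x≢x | _     = ⊥-elim (x≢x refl)
  ... | yes _ | no y≢y = ⊥-elim (y≢y refl)

  pathEdges-tail : ∀ {x y z} (e : E x y ≡ true) (q : Path E y z) → pathEdges q ⊆E pathEdges (e ∷ q)
  pathEdges-tail {x} {y} e q a b h = trans (cong ((⌊ a ≟ x ⌋ ∧ ⌊ b ≟ y ⌋) ∨_) h) (∨-zeroʳ _)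

  pathEdges-++ : ∀ {x y z a b} (p : Path E x y) (q : Path E y z) →
                 pathEdges (p ++ₚ q) a b ≡ true → pathEdges p a b ≡ true ⊎ pathEdges q a b ≡ true
  pathEdges-++ []      q h = inj₂ h
  pathEdges-++ (e ∷ p) q h with pathEdges-∷ e (p ++ₚ q) h
  ... | inj₁ (refl , refl) = inj₁ (pathEdges-head e p)
  ... | inj₂ h' with pathEdges-++ p q h'
  ...   | inj₁ in-p = inj₁ (pathEdges-tail e p _ _ in-p)
  ...   | inj₂ in-q = inj₂ in-q

  pathEdges-⊆ : ∀ {x y} (p : Path E x y) → pathEdges p ⊆E E
  pathEdges-⊆ []      a b ()
  pathEdges-⊆ (e ∷ p) a b h with pathEdges-∷ e p h
  ... | inj₁ (refl , refl) = e
  ... | inj₂ h'            = pathEdges-⊆ p a b h'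

  reach-edge : ∀ {x y a b} (p : Path E x y) → pathEdges p a b ≡ true → Path E x a
  reach-edge []      ()
  reach-edge (e ∷ p) h with pathEdges-∷ e p h
  ... | inj₁ (refl , refl) = []
  ... | inj₂ h'            = e ∷ reach-edge p h'

  reach-end : ∀ {x y a b} (p : Path E x y) → pathEdges p a b ≡ true → Path E b y
  reach-end []      ()
  reach-end (e ∷ p) h with pathEdges-∷ e p h
  ... | inj₁ (refl , refl) = p
  ... | inj₂ h'            = reach-end p h'

  unique-successor : Acyclic E → ∀ {s v w w' t} (r : Path E s v) (e : E v w ≡ true)
                     (q : Path E w t) → pathEdges (r ++ₚ (e ∷ q)) v w' ≡ true → w' ≡ w
  unique-successor acyclic {v = v} {w} {w'} r e q h with pathEdges-++ r (e ∷ q) h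
  ... | inj₁ in-r = ⊥-elim (acyclic v w' (pathEdges-⊆ r v w' in-r) (reach-end r in-r))
  ... | inj₂ in-eq with pathEdges-∷ e q in-eq
  ...   | inj₁ (_ , w'≡w) = w'≡w
  ...   | inj₂ in-q       = ⊥-elim (acyclic v w e (reach-edge q in-q))

  asPathIn : ∀ {F : EdgeSet n} {x y} (p : Path E x y) → pathEdges p ⊆E F → Path F x y
  asPathIn []                  _   = []
  asPathIn (_∷_ {x} {y} e p) p⊆F =
    p⊆F x y (pathEdges-head e p) ∷ asPathIn p (λ a b h → p⊆F a b (pathEdges-tail e p a b h))

  asPathIn-cost : ∀ {F : EdgeSet n} (c : Fin n → Fin n → ℚ) {x y} (p : Path E x y)
                  (p⊆F : pathEdges p ⊆E F) → pathCost c (asPathIn p p⊆F) ≡ pathCost c p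
  asPathIn-cost c []                _   = refl
  asPathIn-cost c (_∷_ {x} {y} e p) p⊆F =
    cong (c x y +_) (asPathIn-cost c p (λ a b h → p⊆F a b (pathEdges-tail e p a b h)))

  edge-remainder : ∀ {F : EdgeSet n} (c : Fin n → Fin n → ℚ) → NonNegCosts c →
                   ∀ {x y a b} (p : Path E x y) → pathEdges p ⊆E F → pathEdges p a b ≡ true →
                   Σ (Path F b y) λ rest → c a b + pathCost c rest ≤ pathCost c p
  edge-remainder c nonneg []                _   ()
  edge-remainder c nonneg (_∷_ {x} {y} e p) p⊆F h with pathEdges-∷ e p h
  ... | inj₁ (refl , refl) = asPathIn p tail⊆F , ≤-reflexive (cong (c x y +_) (asPathIn-cost c p tail⊆F))
    where
      tail⊆F : pathEdges p ⊆E _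
      tail⊆F a b h = p⊆F a b (pathEdges-tail e p a b h)
  ... | inj₂ h' with edge-remainder c nonneg p (λ a b h → p⊆F a b (pathEdges-tail e p a b h)) h'
  ...   | rest , ≤p = rest , ≤-trans ≤p
          (subst (_≤ c x y + pathCost c p) (+-identityˡ _) (+-monoˡ-≤ (pathCost c p) (nonneg x y)))

module PathMotivating {n : ℕ} {E : EdgeSet n} (c : Fin n → Fin n → ℚ) {s t : Fin n}
                      (β r : ℚ) (acyclic : Acyclic E) (P : Path E s t)
                      (bounded : ∀ (v : Fin n) (z : ℚ∞) → v ∈ₚ P → v ≢ t →
                                 IsZeta (pathEdges P) c t β v z → z ≤∞ fin (β * r)) where

  suffix-succeeds : ∀ {v} (p : Path E s v) (q : Path E v t) → p ++ₚ q ≡ P →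
                    Succeeds (pathEdges P) c t β r v
  suffix-succeeds p []                _     = done refl
  suffix-succeeds p (_∷_ {v} {w} e q) split = go v≢t (λ z → bounded v z v∈P v≢t) next
    where
      v≢t : v ≢ t
      v≢t refl = acyclic v w e q

      v∈P : v ∈ₚ P
      v∈P = subst (v ∈ₚ_) split (∈ₚ-++ʳ p here)

      next : ∀ w' (dw z : ℚ∞) → pathEdges P v w' ≡ true → IsDist (pathEdges P) c t w' dw →
             IsZeta (pathEdges P) c t β v z → plusScaled β (c v w') dw ≡ z →
             Succeeds (pathEdges P) c t β r w'
      next w' _ _ e' _ _ _
        rewrite unique-successor acyclic p e q (subst (λ P → pathEdges P v w' ≡ true) (sym split) e') =
        suffix-succeeds (p ++ₚ (e ∷ [])) q (trans (++ₚ-assoc p (e ∷ []) q) split)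

  motivating : Motivating (pathEdges P) c s t β r
  motivating = suffix-succeeds [] P refl

module _ {n : ℕ} {E : EdgeSet n} (c : Fin n → Fin n → ℚ) (nonneg : NonNegCosts c)
         {t : Fin n} {β : ℚ} (0≤β : 0ℚ ≤ β) (β≤1 : β ≤ 1ℚ) where

  zeta-≤-cost : ∀ {s v z q} (P : Path E s t) →
                IsZeta (pathEdges P) c t β v z → z ≡ fin q → q ≤ pathCost c P
  zeta-≤-cost P (noOut _)                     ()
  zeta-≤-cost P (attained w _ e (unreach _) _) ()
  zeta-≤-cost {v = v} P (attained w _ e (reach d d-least) _) refl
    with edge-remainder c nonneg P (λ _ _ h → h) e
  ... | rest , ≤P =
    ≤-trans (+-monoʳ-≤ (c v w) (*-monoˡ-≤-nonNeg β {{nonNegative 0≤β}} (d-least rest)))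
      (≤-trans (+-monoʳ-≤ (c v w) (scale-≤ β _ β≤1 (cost-nonneg c nonneg rest))) ≤P)

  maxZeta-≤-cost : ∀ {s m} (P : Path E s t) → IsMaxZeta E c β P (fin m) → m ≤ pathCost c P
  maxZeta-≤-cost P (_ , inj₁ (_ , _ , _ , ζ-is-max)) = zeta-≤-cost P ζ-is-max refl
  maxZeta-≤-cost P (_ , inj₂ (_ , refl))             = cost-nonneg c nonneg P

  zeta-≥-cost : ∀ {s x z} {F : EdgeSet n} → F ⊆E E → (P : Path E s t) → IsCheapest E c P →
                IsZeta F c t β s z → z ≤∞ fin x → β * pathCost c P ≤ x
  zeta-≥-cost {s} F⊆E P cheapest (attained w _ e (reach d _) _) (fin≤fin ζ≤x) =
    ≤-trans (*-monoˡ-≤-nonNeg β {{nonNegative 0≤β}} P≤via-w)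
      (≤-trans (≤-reflexive (*-distribˡ-+ β (c s w) (pathCost c d)))
        (≤-trans (+-monoˡ-≤ (β * pathCost c d) (scale-≤ β (c s w) β≤1 (nonneg s w))) ζ≤x))
    where
      P≤via-w : pathCost c P ≤ c s w + pathCost c d
      P≤via-w = ≤-trans (cheapest (embed F⊆E (e ∷ d))) (≤-reflexive (embed-cost c F⊆E (e ∷ d)))

motivating-reward-≥-cost :
  ∀ {n} {E F : EdgeSet n} (c : Fin n → Fin n → ℚ) {s t : Fin n} {β r' : ℚ} →
  IsTaskGraph E c s t → 0ℚ < β → β ≤ 1ℚ → (P : Path E s t) → IsCheapest E c P →
  F ⊆E E → 0ℚ ≤ r' → Motivating F c s t β r' → pathCost c P ≤ r'
motivating-reward-≥-cost c tg 0<β β≤1 P cheapest F⊆E 0≤r' (done s≡t) =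
  subst (_≤ _) (sym (loop-cost c (IsTaskGraph.acyclic tg) P s≡t)) 0≤r'
motivating-reward-≥-cost {F = F} c {s} {t} {β} tg 0<β β≤1 P cheapest F⊆E 0≤r' (go _ no-abandon _) =
  *-cancelˡ-≤-pos β {{positive 0<β}}
    (zeta-≥-cost c (IsTaskGraph.nonneg tg) (<⇒≤ 0<β) β≤1 F⊆E P cheapest ζ-s (no-abandon _ ζ-s))
  where
    ζ-s : IsZeta F c t β s _
    ζ-s = proj₂ (Existence.zeta F c t (acyclic-⊆ F⊆E (IsTaskGraph.acyclic tg)) β (<⇒≤ 0<β) s)

proposition4 : ∀ {n : ℕ} (E : EdgeSet n) (c : Fin n → Fin n → ℚ) (s t : Fin n)
    (β : ℚ) → IsTaskGraph E c s t → 0ℚ < β → β < 1ℚ →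
    (P : Path E s t) → IsCheapest E c P →
    (r : ℚ) → IsMaxZeta E c β P (fin (β * r)) →
    Motivating (pathEdges P) c s t β r
    × (∀ (E' : EdgeSet n) (r' : ℚ) → E' ⊆E E → 0ℚ ≤ r' →
         Motivating E' c s t β r' → β * r ≤ r')
proposition4 {n} E c s t β tg 0<β β<1 P cheapest r maxZeta@(bounded , _) =
  PathMotivating.motivating c β r (IsTaskGraph.acyclic tg) P bounded , optimal
  where
    optimal : ∀ (E' : EdgeSet n) (r' : ℚ) → E' ⊆E E → 0ℚ ≤ r' →
              Motivating E' c s t β r' → β * r ≤ r'
    optimal E' r' E'⊆E 0≤r' motivating =
      ≤-trans (maxZeta-≤-cost c (IsTaskGraph.nonneg tg) (<⇒≤ 0<β) (<⇒≤ β<1) P maxZeta)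
              (motivating-reward-≥-cost c tg 0<β (<⇒≤ β<1) P cheapest E'⊆E 0≤r' motivating)
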